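{- Let $m,n$ be nonnegative integers with $2m+n>6$. Then there is no code $C$ in $D(m,n)$ with $|C|=4^{2m+n-3}$ and code distance $4$.
   Context: The Shrikhande graph $\mathrm{Sh}$ is the Cayley graph on $\mathbb{Z}_4^2$ with connection set $\{01,03,10,30,11,33\}$; $K$ is the complete graph on $\mathbb{Z}_4$. $D(m,n)$ is the Cartesian product of $m$ copies of $\mathrm{Sh}$ and $n$ copies of $K$, with distance equal to the sum of coordinatewise graph distances. The code distance of a code is the minimum distance between distinct codewords. -}

module Defs where

open import Data.Nat using (ℕ; zero; suc; _+_; _*_; _∸_; _^_; _≤_; _≡ᵇ_)
open import Data.Bool using (Bool; true; false; _∨_; _∧_; if_then_else_)
open import Data.Fin using (Fin; toℕ)
open import Data.Fin.Properties using (_≟_)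
open import Data.Product using (_×_; _,_; Σ; ∃)
open import Data.Vec using (Vec; []; _∷_)
open import Data.List using (List; length; allFin; foldr)
open import Data.Bool.ListAction using (any)
open import Data.List.Relation.Unary.Unique.Propositional using (Unique)
open import Relation.Binary.PropositionalEquality using (_≡_; _≢_)
open import Relation.Nullary.Decidable using (⌊_⌋)

Z4 : Set
Z4 = Fin 4

sub4 : Z4 → Z4 → ℕ
sub4 a b = (toℕ a + 4 ∸ toℕ b) Data.Nat.% 4

-- Shrikhande graph: Cayley graph on Z_4^2, connection set {01,03,10,30,11,33}
ShV : Set
ShV = Z4 × Z4

inConn : ℕ → ℕ → Bool
inConn 0 1 = true
inConn 0 3 = true
inConn 1 0 = true
inConn 3 0 = true
inConn 1 1 = true
inConn 3 3 = true
inConn _ _ = false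

shAdj : ShV → ShV → Bool
shAdj (a₁ , a₂) (b₁ , b₂) = inConn (sub4 b₁ a₁) (sub4 b₂ a₂)

kAdj : Z4 → Z4 → Bool
kAdj a b = Data.Bool.not ⌊ a ≟ b ⌋

record FinGraph : Set₁ where
  field
    V     : Set
    verts : List V
    adj   : V → V → Bool
    eqb   : V → V → Bool

walkb : (G : FinGraph) → ℕ → FinGraph.V G → FinGraph.V G → Bool
walkb G zero u v = FinGraph.eqb G u v
walkb G (suc k) u v =
  walkb G k u v ∨ any (λ w → walkb G k u w ∧ FinGraph.adj G w v) (FinGraph.verts G)

-- graph distance: least k ≤ bound with a walk of length ≤ k (search up to the
-- number of vertices, which suffices for connected graphs; both graphs used are connected)
distFrom : (G : FinGraph) → ℕ → ℕ → FinGraph.V G → FinGraph.V G → ℕ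
distFrom G k zero u v = k
distFrom G k (suc fuel) u v =
  if walkb G k u v then k else distFrom G (suc k) fuel u v

gdist : (G : FinGraph) → FinGraph.V G → FinGraph.V G → ℕ
gdist G u v = distFrom G 0 (length (FinGraph.verts G)) u v

allZ4 : List Z4
allZ4 = allFin 4

allShV : List ShV
allShV = Data.List.concatMap (λ a → Data.List.map (λ b → (a , b)) allZ4) allZ4

Sh : FinGraph
Sh = record
  { V = ShV ; verts = allShV ; adj = shAdj
  ; eqb = λ { (a₁ , a₂) (b₁ , b₂) → ⌊ a₁ ≟ b₁ ⌋ ∧ ⌊ a₂ ≟ b₂ ⌋ } }

K : FinGraph
K = record { V = Z4 ; verts = allZ4 ; adj = kAdj ; eqb = λ a b → ⌊ a ≟ b ⌋ }

D : ℕ → ℕ → Set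
D m n = Vec ShV m × Vec Z4 n

sumDist : (G : FinGraph) → ∀ {k} → Vec (FinGraph.V G) k → Vec (FinGraph.V G) k → ℕ
sumDist G [] [] = 0
sumDist G (x ∷ xs) (y ∷ ys) = gdist G x y + sumDist G xs ys

dD : ∀ {m n} → D m n → D m n → ℕ
dD (s , k) (s' , k') = sumDist Sh s s' + sumDist K k k'

-- A code in D(m,n): a duplicate-free list of vertices (its size is its length)
-- Code distance = d : every two distinct codewords are at distance ≥ d, and
-- some two distinct codewords are at distance exactly d.
open import Data.List.Membership.Propositional using (_∈_)

HasCodeDistance : ∀ {m n} → List (D m n) → ℕ → Set
HasCodeDistance {m} {n} C d =
  (∀ x y → x ∈ C → y ∈ C → x ≢ y → d ≤ dD x y) ×
  Σ (D m n) (λ x → Σ (D m n) (λ y → x ∈ C × y ∈ C × x ≢ y × dD x y ≡ d))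

-- The proof double-counts pairs (codeword c, vertex v) weighted by a function
-- h of their distance.  Per codeword the weight is bounded below by the
-- distance profile of D(m,n): one vertex at distance 0, 6m + 3n at distance 1
-- and at least 18m² − 9m at distance 2 (profiles multiply over products).  Per
-- vertex the weight is bounded above by a packing argument; as D(m,n) has
-- 4^(2m+n) vertices, comparing the totals gives the contradiction.
--   * n ≥ 1: deleting a K-coordinate leaves 4^(2m+n−3) words of minimum
--     distance 3 in D(m,n−1); their disjoint radius-1 balls have size
--     1 + 3(2m+n−1) ≥ 19 > 16 = 4^(2m+n−1) / 4^(2m+n−3).
--   * n = 0: with h = 3m·[d ≤ 1] + 2·[d = 2] every vertex receives weight at
--     most 3m: codewords at distance 2 from v lie pairwise on geodesics
--     through v, and in each Sh-coordinate such points have distances to v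
--     summing to at most 3 (the neighbourhood of a vertex of Sh is a hexagon).
module Submission where

open import Defs
open import Data.Nat using (ℕ; zero; suc; _+_; _*_; _∸_; _^_; _<_; _≤_; z≤n; s≤s; _≡ᵇ_)
open import Data.Nat.Properties
open import Data.Nat.Tactic.RingSolver using (solve-∀)
open import Algebra.Properties.CommutativeSemigroup +-commutativeSemigroup
  using () renaming (interchange to +-interchange)
open import Data.Bool using (true; false; if_then_else_)
open import Data.Fin using (Fin; zero; suc)
open import Data.Fin.Properties using (all?)
open import Data.Product using (_×_; _,_; proj₁; proj₂; Σ)
open import Data.Vec using (Vec; []; _∷_; head; tail)
open import Data.List using (List; []; _∷_; length; map; _++_; cartesianProductWith; filter)
open import Data.List.Properties using (length-++; length-map)
open import Data.List.Membership.Propositional using (_∈_)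
open import Data.List.Relation.Unary.Any using (here; there)
open import Data.List.Relation.Unary.All using (All; []; _∷_)
import Data.List.Relation.Unary.All as All
open import Data.List.Relation.Unary.All.Properties using (all-filter)
open import Data.List.Relation.Unary.AllPairs using (AllPairs; []; _∷_)
import Data.List.Relation.Unary.AllPairs as AllPairs
open import Data.List.Relation.Unary.AllPairs.Properties using (map⁺; filter⁺)
open import Data.List.Relation.Unary.Unique.Propositional using (Unique)
open import Relation.Binary.PropositionalEquality
open import Relation.Nullary using (¬_; Dec; does; yes; no; map′)
open import Relation.Nullary.Decidable using (from-yes; from-no; _→-dec_)
open import Relation.Unary using (Decidable)
open import Data.Empty using (⊥; ⊥-elim)
open import Function using (_∘_)

variable
  A B C X Y Z : Set

∑ : List A → (A → ℕ) → ℕ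
∑ [] f = 0
∑ (x ∷ xs) f = f x + ∑ xs f

syntax ∑ xs (λ x → e) = ∑[ x ← xs ] e

∑-cong : {f g : A → ℕ} (xs : List A) → (∀ x → f x ≡ g x) → ∑ xs f ≡ ∑ xs g
∑-cong [] e = refl
∑-cong (x ∷ xs) e = cong₂ _+_ (e x) (∑-cong xs e)

∑-mono : {f g : A → ℕ} (xs : List A) → (∀ x → f x ≤ g x) → ∑ xs f ≤ ∑ xs g
∑-mono [] le = z≤n
∑-mono (x ∷ xs) le = +-mono-≤ (le x) (∑-mono xs le)

∑-+ : (f g : A → ℕ) (xs : List A) → ∑[ x ← xs ] (f x + g x) ≡ ∑ xs f + ∑ xs g
∑-+ f g [] = refl
∑-+ f g (x ∷ xs) =
  trans (cong (f x + g x +_) (∑-+ f g xs)) (+-interchange (f x) (g x) (∑ xs f) (∑ xs g))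

∑-*ˡ : (c : ℕ) (f : A → ℕ) (xs : List A) → ∑[ x ← xs ] (c * f x) ≡ c * ∑ xs f
∑-*ˡ c f [] = sym (*-zeroʳ c)
∑-*ˡ c f (x ∷ xs) = trans (cong (c * f x +_) (∑-*ˡ c f xs)) (sym (*-distribˡ-+ c (f x) (∑ xs f)))

∑-const : (c : ℕ) (xs : List A) → ∑[ _ ← xs ] c ≡ length xs * c
∑-const c [] = refl
∑-const c (x ∷ xs) = cong (c +_) (∑-const c xs)

∑-++ : (f : A → ℕ) (xs ys : List A) → ∑ (xs ++ ys) f ≡ ∑ xs f + ∑ ys f
∑-++ f [] ys = refl
∑-++ f (x ∷ xs) ys = trans (cong (f x +_) (∑-++ f xs ys)) (sym (+-assoc (f x) (∑ xs f) (∑ ys f)))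

∑-map : (f : B → ℕ) (g : A → B) (xs : List A) → ∑ (map g xs) f ≡ ∑[ x ← xs ] f (g x)
∑-map f g [] = refl
∑-map f g (x ∷ xs) = cong (f (g x) +_) (∑-map f g xs)

∑-product : (g : C → ℕ) (f : A → B → C) (xs : List A) (ys : List B) →
  ∑ (cartesianProductWith f xs ys) g ≡ ∑[ x ← xs ] ∑[ y ← ys ] g (f x y)
∑-product g f [] ys = refl
∑-product g f (x ∷ xs) ys = begin
    ∑ (map (f x) ys ++ cartesianProductWith f xs ys) g
  ≡⟨ ∑-++ g (map (f x) ys) _ ⟩
    ∑ (map (f x) ys) g + ∑ (cartesianProductWith f xs ys) g
  ≡⟨ cong₂ _+_ (∑-map g (f x) ys) (∑-product g f xs ys) ⟩
    ∑[ y ← ys ] g (f x y) + ∑[ x ← xs ] ∑[ y ← ys ] g (f x y)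
  ∎
  where open ≡-Reasoning

∑-swap : (F : A → B → ℕ) (xs : List A) (ys : List B) →
  ∑[ x ← xs ] ∑[ y ← ys ] F x y ≡ ∑[ y ← ys ] ∑[ x ← xs ] F x y
∑-swap F [] ys = sym (trans (∑-const 0 ys) (*-zeroʳ (length ys)))
∑-swap F (x ∷ xs) ys = trans (cong (∑ ys (F x) +_) (∑-swap F xs ys)) (sym (∑-+ (F x) _ ys))

∑-filter : {P : A → Set} (P? : Decidable P) (f : A → ℕ) (xs : List A) →
  ∑ (filter P? xs) f ≡ ∑[ x ← xs ] (if does (P? x) then f x else 0)
∑-filter P? f [] = refl
∑-filter P? f (x ∷ xs) with does (P? x)
... | true = cong (f x +_) (∑-filter P? f xs)
... | false = ∑-filter P? f xs

∑-positive : (w : A → ℕ) (xs : List A) → 1 ≤ ∑ xs w → Σ A (λ x → x ∈ xs × 1 ≤ w x)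
∑-positive w [] ()
∑-positive w (x ∷ xs) pos with w x in eq
... | suc _ = x , here refl , subst (1 ≤_) (sym eq) (s≤s z≤n)
... | zero with ∑-positive w xs pos
...   | y , y∈xs , wy = y , there y∈xs , wy

∑-zero : (w : A → ℕ) (xs : List A) → (∀ x → x ∈ xs → w x ≡ 0) → ∑ xs w ≡ 0
∑-zero w [] vanish = refl
∑-zero w (x ∷ xs) vanish =
  cong₂ _+_ (vanish x (here refl)) (∑-zero w xs (λ y y∈xs → vanish y (there y∈xs)))

∑-atMostOne : (w : A → ℕ) → (∀ x → w x ≤ 1) → {xs : List A} →
  AllPairs (λ a b → w a + w b ≤ 1) xs → ∑ xs w ≤ 1
∑-atMostOne w w≤1 [] = z≤n
∑-atMostOne w w≤1 {a ∷ xs} (excl ∷ rest) with w a | w≤1 a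
... | zero | _ = ∑-atMostOne w w≤1 rest
... | suc zero | _ =
  ≤-reflexive (cong suc (∑-zero w xs (λ b b∈xs → n≤0⇒n≡0 (≤-pred (All.lookup excl b∈xs)))))
... | suc (suc _) | s≤s ()

unique⇒allPairs : {R : A → A → Set} {xs : List A} → Unique xs →
  (∀ x y → x ∈ xs → y ∈ xs → x ≢ y → R x y) → AllPairs R xs
unique⇒allPairs [] related = []
unique⇒allPairs {xs = x ∷ xs} (x∉xs ∷ rest) related =
  All.tabulate (λ y∈xs → related x _ (here refl) (there y∈xs) (All.lookup x∉xs y∈xs))
  ∷ unique⇒allPairs rest (λ a b a∈xs b∈xs → related a b (there a∈xs) (there b∈xs))

allPairs-discharge : {P : A → Set} {R : A → A → Set} {xs : List A} → All P xs →
  AllPairs (λ a b → P a → P b → R a b) xs → AllPairs R xs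
allPairs-discharge [] [] = []
allPairs-discharge (pa ∷ ps) (r ∷ rs) =
  All.zipWith (λ (f , pb) → f pa pb) (r , ps) ∷ allPairs-discharge ps rs

record IsDistance (d : X → X → ℕ) : Set where
  field
    symmetric : ∀ x y → d x y ≡ d y x
    triangle : ∀ x y z → d x z ≤ d x y + d y z

Between : (X → X → ℕ) → X → X → X → Set
Between d v a b = d v a + d v b ≤ d a b

GeodesicBound : (X → X → ℕ) → ℕ → Set
GeodesicBound {X} d β = (v : X) (L : List X) → AllPairs (Between d v) L → ∑[ a ← L ] d v a ≤ β

-- Products: dZ splits as the sum of dX on the p-component and dY on the
-- q-component (used both for Vec (suc k) = head, tail and for D = Sh^m × K^n).
module _ {dX : X → X → ℕ} {dY : Y → Y → ℕ} {dZ : Z → Z → ℕ} (p : Z → X) (q : Z → Y)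
         (split : ∀ z z′ → dZ z z′ ≡ dX (p z) (p z′) + dY (q z) (q z′))
         (isDistX : IsDistance dX) (isDistY : IsDistance dY) where
  private
    module X = IsDistance isDistX
    module Y = IsDistance isDistY

  isDistance-product : IsDistance dZ
  isDistance-product = record
    { symmetric = λ z z′ → trans (split z z′)
        (trans (cong₂ _+_ (X.symmetric (p z) (p z′)) (Y.symmetric (q z) (q z′))) (sym (split z′ z)))
    ; triangle = λ z z′ z″ → subst₂ _≤_ (sym (split z z″)) (sym (cong₂ _+_ (split z z′) (split z′ z″)))
        (≤-trans (+-mono-≤ (X.triangle (p z) (p z′) (p z″)) (Y.triangle (q z) (q z′) (q z″)))
                 (≤-reflexive (+-interchange (dX (p z) (p z′)) (dX (p z′) (p z″))
                                             (dY (q z) (q z′)) (dY (q z′) (q z″)))))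
    }

  between-factors : ∀ v a b → Between dZ v a b → Between dX (p v) (p a) (p b) × Between dY (q v) (q a) (q b)
  between-factors v a b btw =
      +-cancelʳ-≤ _ _ _ (≤-trans sum≤ (+-monoʳ-≤ (dX (p a) (p b)) Y-tri))
    , +-cancelˡ-≤ _ _ _ (≤-trans sum≤ (+-monoˡ-≤ (dY (q a) (q b)) X-tri))
    where
    X-tri : dX (p a) (p b) ≤ dX (p v) (p a) + dX (p v) (p b)
    X-tri = subst (λ t → dX (p a) (p b) ≤ t + dX (p v) (p b)) (X.symmetric (p a) (p v))
                  (X.triangle (p a) (p v) (p b))
    Y-tri : dY (q a) (q b) ≤ dY (q v) (q a) + dY (q v) (q b)
    Y-tri = subst (λ t → dY (q a) (q b) ≤ t + dY (q v) (q b)) (Y.symmetric (q a) (q v))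
                  (Y.triangle (q a) (q v) (q b))
    sum≤ : dX (p v) (p a) + dX (p v) (p b) + (dY (q v) (q a) + dY (q v) (q b)) ≤ dX (p a) (p b) + dY (q a) (q b)
    sum≤ = subst₂ _≤_
      (trans (cong₂ _+_ (split v a) (split v b))
             (+-interchange (dX (p v) (p a)) (dY (q v) (q a)) (dX (p v) (p b)) (dY (q v) (q b))))
      (split a b) btw

  geodesicBound-product : ∀ {β γ} → GeodesicBound dX β → GeodesicBound dY γ → GeodesicBound dZ (β + γ)
  geodesicBound-product {β} {γ} boundX boundY v L between = begin
      ∑[ a ← L ] dZ v a
    ≡⟨ trans (∑-cong L (split v)) (∑-+ _ _ L) ⟩
      ∑[ a ← L ] dX (p v) (p a) + ∑[ a ← L ] dY (q v) (q a)
    ≡⟨ sym (cong₂ _+_ (∑-map (dX (p v)) p L) (∑-map (dY (q v)) q L)) ⟩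
      ∑ (map p L) (dX (p v)) + ∑ (map q L) (dY (q v))
    ≤⟨ +-mono-≤ (boundX (p v) (map p L) (map⁺ (AllPairs.map (λ {a} {b} → proj₁ ∘ between-factors v a b) between)))
                (boundY (q v) (map q L) (map⁺ (AllPairs.map (λ {a} {b} → proj₂ ∘ between-factors v a b) between))) ⟩
      β + γ
    ∎
    where open ≤-Reasoning

-- `Profile xs δ a₁ a₂`: seen from a centre with distance function δ, the list xs
-- weighs at least as much as one point at distance 0, a₁ points at distance 1
-- and a₂ points at distance 2, for every weighting h of the distances.
record Profile (xs : List X) (δ : X → ℕ) (a₁ a₂ : ℕ) : Set where
  field
    weigh : (h : ℕ → ℕ) → h 0 + a₁ * h 1 + a₂ * h 2 ≤ ∑[ x ← xs ] h (δ x)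
open Profile

profile-weaken : ∀ {xs : List X} {δ a₁ a₂ b₁ b₂} → b₁ ≤ a₁ → b₂ ≤ a₂ → Profile xs δ a₁ a₂ → Profile xs δ b₁ b₂
profile-weaken b₁≤a₁ b₂≤a₂ profile .weigh h =
  ≤-trans (+-mono-≤ (+-monoʳ-≤ (h 0) (*-monoˡ-≤ (h 1) b₁≤a₁)) (*-monoˡ-≤ (h 2) b₂≤a₂)) (profile .weigh h)

-- Profiles multiply over products when distances add: the product has 1 point
-- at distance 0, a₁ + b₁ at distance 1, and at distance 2 at least the
-- a₂ + a₁b₁ + b₂ points with both factor distances at most 2.
profile-product : (f : X → Y → Z) (xs : List X) (ys : List Y) {δX : X → ℕ} {δY : Y → ℕ} {δZ : Z → ℕ}
  {a₁ a₂ b₁ b₂ : ℕ} → (∀ x y → δZ (f x y) ≡ δX x + δY y) → Profile xs δX a₁ a₂ → Profile ys δY b₁ b₂ →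
  Profile (cartesianProductWith f xs ys) δZ (a₁ + b₁) (a₂ + a₁ * b₁ + b₂)
profile-product f xs ys {δX} {δY} {δZ} {a₁} {a₂} {b₁} {b₂} additive profileX profileY .weigh h = begin
    h 0 + (a₁ + b₁) * h 1 + (a₂ + a₁ * b₁ + b₂) * h 2
  ≡⟨ regroup (h 0) (h 1) (h 2) a₁ a₂ b₁ b₂ ⟩
    (h 0 + a₁ * h 1 + a₂ * h 2) + b₁ * (h 1 + a₁ * h 2) + b₂ * h 2
  ≤⟨ +-mono-≤ (+-mono-≤ (profileX .weigh h) (*-monoʳ-≤ b₁ (shifted 1)))
              (*-monoʳ-≤ b₂ (≤-trans (m≤m+n (h 2) _) (shifted 2))) ⟩
    ∑[ x ← xs ] h (δX x) + b₁ * ∑[ x ← xs ] h (δX x + 1) + b₂ * ∑[ x ← xs ] h (δX x + 2)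
  ≡⟨ sym (trans (∑-+ _ _ xs) (cong₂ _+_ (trans (∑-+ _ _ xs) (cong (∑[ x ← xs ] h (δX x) +_) (∑-*ˡ b₁ _ xs)))
                                       (∑-*ˡ b₂ _ xs))) ⟩
    ∑[ x ← xs ] (h (δX x) + b₁ * h (δX x + 1) + b₂ * h (δX x + 2))
  ≤⟨ ∑-mono xs fibre ⟩
    ∑[ x ← xs ] ∑[ y ← ys ] h (δX x + δY y)
  ≡⟨ sym (trans (∑-product (λ z → h (δZ z)) f xs ys)
                (∑-cong xs (λ x → ∑-cong ys (λ y → cong h (additive x y))))) ⟩
    ∑[ z ← cartesianProductWith f xs ys ] h (δZ z)
  ∎
  where
  open ≤-Reasoning
  regroup : ∀ h₀ h₁ h₂ a₁ a₂ b₁ b₂ → h₀ + (a₁ + b₁) * h₁ + (a₂ + a₁ * b₁ + b₂) * h₂ ≡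
    (h₀ + a₁ * h₁ + a₂ * h₂) + b₁ * (h₁ + a₁ * h₂) + b₂ * h₂
  regroup = solve-∀
  shifted : ∀ j → h j + a₁ * h (1 + j) ≤ ∑[ x ← xs ] h (δX x + j)
  shifted j = ≤-trans (m≤m+n _ _) (profileX .weigh (λ i → h (i + j)))
  fibre : ∀ x → h (δX x) + b₁ * h (δX x + 1) + b₂ * h (δX x + 2) ≤ ∑[ y ← ys ] h (δX x + δY y)
  fibre x = subst (λ i → h i + b₁ * h (δX x + 1) + b₂ * h (δX x + 2) ≤ ∑[ y ← ys ] h (δX x + δY y))
                  (+-identityʳ (δX x)) (profileY .weigh (λ i → h (δX x + i)))

indicator : ℕ → ℕ → ℕ
indicator k j = if j ≡ᵇ k then 1 else 0

count : ℕ → (X → ℕ) → List X → ℕ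
count k δ xs = ∑[ x ← xs ] indicator k (δ x)

∑-by-count : (h : ℕ → ℕ) (δ : X → ℕ) → (∀ x → δ x ≤ 2) → (xs : List X) →
  ∑[ x ← xs ] h (δ x) ≡ count 0 δ xs * h 0 + count 1 δ xs * h 1 + count 2 δ xs * h 2
∑-by-count h δ bounded [] = refl
∑-by-count h δ bounded (x ∷ xs) =
  trans (cong₂ _+_ (decompose (δ x) (bounded x)) (∑-by-count h δ bounded xs))
        (collect (indicator 0 (δ x)) (indicator 1 (δ x)) (indicator 2 (δ x))
                 (count 0 δ xs) (count 1 δ xs) (count 2 δ xs) (h 0) (h 1) (h 2))
  where
  decompose : ∀ j → j ≤ 2 → h j ≡ indicator 0 j * h 0 + indicator 1 j * h 1 + indicator 2 j * h 2
  decompose 0 _ = sym (trans (+-identityʳ _) (trans (+-identityʳ _) (+-identityʳ _)))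
  decompose 1 _ = sym (trans (+-identityʳ _) (+-identityʳ _))
  decompose 2 _ = sym (+-identityʳ _)
  decompose (suc (suc (suc _))) (s≤s (s≤s ()))
  collect : ∀ i₀ i₁ i₂ c₀ c₁ c₂ h₀ h₁ h₂ → (i₀ * h₀ + i₁ * h₁ + i₂ * h₂) + (c₀ * h₀ + c₁ * h₁ + c₂ * h₂) ≡
    (i₀ + c₀) * h₀ + (i₁ + c₁) * h₁ + (i₂ + c₂) * h₂
  collect = solve-∀

profile-from-counts : {xs : List X} {δ : X → ℕ} → (∀ x → δ x ≤ 2) → count 0 δ xs ≡ 1 →
  Profile xs δ (count 1 δ xs) (count 2 δ xs)
profile-from-counts {xs = xs} {δ} bounded unique .weigh h = ≤-reflexive (sym (begin
    ∑[ x ← xs ] h (δ x)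
  ≡⟨ ∑-by-count h δ bounded xs ⟩
    count 0 δ xs * h 0 + count 1 δ xs * h 1 + count 2 δ xs * h 2
  ≡⟨ cong (λ t → t + count 1 δ xs * h 1 + count 2 δ xs * h 2)
          (trans (cong (_* h 0) unique) (*-identityˡ (h 0))) ⟩
    h 0 + count 1 δ xs * h 1 + count 2 δ xs * h 2
  ∎))
  where open ≡-Reasoning

double-count : (C : List A) (V : List B) (f : A → B → ℕ) {t L : ℕ} →
  (∀ v → ∑[ c ← C ] f c v ≤ t) → (∀ c → L ≤ ∑[ v ← V ] f c v) → length C * L ≤ length V * t
double-count C V f {t} {L} perVertex perCodeword = begin
    length C * L
  ≡⟨ sym (∑-const L C) ⟩
    ∑[ _ ← C ] L
  ≤⟨ ∑-mono C perCodeword ⟩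
    ∑[ c ← C ] ∑[ v ← V ] f c v
  ≡⟨ ∑-swap f C V ⟩
    ∑[ v ← V ] ∑[ c ← C ] f c v
  ≤⟨ ∑-mono V perVertex ⟩
    ∑[ _ ← V ] t
  ≡⟨ ∑-const t V ⟩
    length V * t
  ∎
  where open ≤-Reasoning

∀ShV? : {P : ShV → Set} → Decidable P → Dec (∀ x → P x)
∀ShV? P? = map′ (λ f (a , b) → f a b) (λ f a b → f (a , b)) (all? λ a → all? λ b → P? (a , b))

-- Distance in Sh read off from the difference of the endpoints (Sh has diameter 2).
diffDist : ℕ → ℕ → ℕ
diffDist 0 0 = 0
diffDist a b = if inConn a b then 1 else 2

shDist : ShV → ShV → ℕ
shDist (a₁ , a₂) (b₁ , b₂) = diffDist (sub4 b₁ a₁) (sub4 b₂ a₂)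

gdist-Sh : ∀ x y → gdist Sh x y ≡ shDist x y
gdist-Sh = from-yes (∀ShV? λ x → ∀ShV? λ y → gdist Sh x y ≟ shDist x y)

shDist-sym : ∀ x y → shDist x y ≡ shDist y x
shDist-sym = from-yes (∀ShV? λ x → ∀ShV? λ y → shDist x y ≟ shDist y x)

shDist-tri : ∀ x y z → shDist x z ≤ shDist x y + shDist y z
shDist-tri = from-yes (∀ShV? λ x → ∀ShV? λ y → ∀ShV? λ z → shDist x z ≤? shDist x y + shDist y z)

Sh-isDistance : IsDistance (gdist Sh)
Sh-isDistance = record { symmetric = sym′ ; triangle = tri }
  where
  sym′ : ∀ x y → gdist Sh x y ≡ gdist Sh y x
  sym′ x y = subst₂ _≡_ (sym (gdist-Sh x y)) (sym (gdist-Sh y x)) (shDist-sym x y)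
  tri : ∀ x y z → gdist Sh x z ≤ gdist Sh x y + gdist Sh y z
  tri x y z = subst₂ _≤_ (sym (gdist-Sh x z)) (sym (cong₂ _+_ (gdist-Sh x y) (gdist-Sh y z)))
                         (shDist-tri x y z)

K-≤1 : ∀ x y → gdist K x y ≤ 1
K-≤1 = from-yes (all? λ x → all? λ y → gdist K x y ≤? 1)

K-isDistance : IsDistance (gdist K)
K-isDistance = record
  { symmetric = from-yes (all? λ x → all? λ y → gdist K x y ≟ gdist K y x)
  ; triangle = from-yes (all? λ x → all? λ y → all? λ z → gdist K x z ≤? gdist K x y + gdist K y z)
  }

-- The six neighbours 01, 11, 10, 03, 33, 30 of 00 form a hexagon in this cyclic
-- order; the three classes {01,11}, {10,03}, {33,30} are alternate edges of it.
-- A vertex at distance 2 belongs to every class.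
hexClass : Fin 3 → ℕ → ℕ → ℕ
hexClass _ 0 0 = 0
hexClass zero 0 1 = 1
hexClass zero 1 1 = 1
hexClass (suc zero) 1 0 = 1
hexClass (suc zero) 0 3 = 1
hexClass (suc (suc zero)) 3 3 = 1
hexClass (suc (suc zero)) 3 0 = 1
hexClass _ a b = if inConn a b then 0 else 1

classWeight : Fin 3 → ShV → ShV → ℕ
classWeight k (a₁ , a₂) (b₁ , b₂) = hexClass k (sub4 b₁ a₁) (sub4 b₂ a₂)

allClasses : ShV → ShV → ℕ
allClasses v x = classWeight zero v x + classWeight (suc zero) v x + classWeight (suc (suc zero)) v x

classWeight-covers : ∀ v x → shDist v x ≤ allClasses v x
classWeight-covers = from-yes (∀ShV? λ v → ∀ShV? λ x → shDist v x ≤? allClasses v x)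

classWeight-≤1 : ∀ k v x → classWeight k v x ≤ 1
classWeight-≤1 = from-yes (all? λ k → ∀ShV? λ v → ∀ShV? λ x → classWeight k v x ≤? 1)

classWeight-exclusive : ∀ k v x y → shDist v x + shDist v y ≤ shDist x y →
  classWeight k v x + classWeight k v y ≤ 1
classWeight-exclusive = from-yes (all? λ k → ∀ShV? λ v → ∀ShV? λ x → ∀ShV? λ y →
  (shDist v x + shDist v y ≤? shDist x y) →-dec (classWeight k v x + classWeight k v y ≤? 1))

-- In Sh at most three points can be pairwise separated by v (counted with
-- their distance): each hexagon class contains at most one of them.
Sh-geodesicBound : GeodesicBound (gdist Sh) 3
Sh-geodesicBound v L between = begin
    ∑[ a ← L ] gdist Sh v a
  ≡⟨ ∑-cong L (gdist-Sh v) ⟩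
    ∑[ a ← L ] shDist v a
  ≤⟨ ∑-mono L (classWeight-covers v) ⟩
    ∑[ a ← L ] allClasses v a
  ≡⟨ trans (∑-+ _ _ L) (cong (_+ ∑ L (w (suc (suc zero)))) (∑-+ _ _ L)) ⟩
    ∑ L (w zero) + ∑ L (w (suc zero)) + ∑ L (w (suc (suc zero)))
  ≤⟨ +-mono-≤ (+-mono-≤ (oneInClass zero) (oneInClass (suc zero))) (oneInClass (suc (suc zero))) ⟩
    3
  ∎
  where
  open ≤-Reasoning
  w : Fin 3 → ShV → ℕ
  w k = classWeight k v
  oneInClass : ∀ k → ∑ L (w k) ≤ 1
  oneInClass k = ∑-atMostOne (w k) (classWeight-≤1 k v) (AllPairs.map (λ {a} {b} btw →
    classWeight-exclusive k v a b (subst₂ _≤_ (cong₂ _+_ (gdist-Sh v a) (gdist-Sh v b)) (gdist-Sh a b) btw))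
    between)

K-geodesicBound : GeodesicBound (gdist K) 1
K-geodesicBound v L between =
  ∑-atMostOne (gdist K v) (K-≤1 v) (AllPairs.map (λ {a} {b} btw → ≤-trans btw (K-≤1 a b)) between)

profile-Sh : ∀ c → Profile allShV (gdist Sh c) 6 9
profile-Sh c = subst₂ (Profile allShV (gdist Sh c)) (count₁ c) (count₂ c)
  (profile-from-counts {xs = allShV} {δ = gdist Sh c} (bounded c) (count₀ c))
  where
  bounded : ∀ c x → gdist Sh c x ≤ 2
  bounded = from-yes (∀ShV? λ c → ∀ShV? λ x → gdist Sh c x ≤? 2)
  count₀ : ∀ c → count 0 (gdist Sh c) allShV ≡ 1
  count₀ = from-yes (∀ShV? λ c → count 0 (gdist Sh c) allShV ≟ 1)
  count₁ : ∀ c → count 1 (gdist Sh c) allShV ≡ 6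
  count₁ = from-yes (∀ShV? λ c → count 1 (gdist Sh c) allShV ≟ 6)
  count₂ : ∀ c → count 2 (gdist Sh c) allShV ≡ 9
  count₂ = from-yes (∀ShV? λ c → count 2 (gdist Sh c) allShV ≟ 9)

profile-K : ∀ c → Profile allZ4 (gdist K c) 3 0
profile-K c = subst₂ (Profile allZ4 (gdist K c)) (count₁ c) (count₂ c)
  (profile-from-counts {xs = allZ4} {δ = gdist K c} (bounded c) (count₀ c))
  where
  bounded : ∀ c x → gdist K c x ≤ 2
  bounded c x = ≤-trans (K-≤1 c x) (s≤s z≤n)
  count₀ : ∀ c → count 0 (gdist K c) allZ4 ≡ 1
  count₀ = from-yes (all? λ c → count 0 (gdist K c) allZ4 ≟ 1)
  count₁ : ∀ c → count 1 (gdist K c) allZ4 ≡ 3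
  count₁ = from-yes (all? λ c → count 1 (gdist K c) allZ4 ≟ 3)
  count₂ : ∀ c → count 2 (gdist K c) allZ4 ≡ 0
  count₂ = from-yes (all? λ c → count 2 (gdist K c) allZ4 ≟ 0)

sumDist-∷ : (G : FinGraph) {k : ℕ} (x y : Vec (FinGraph.V G) (suc k)) →
  sumDist G x y ≡ gdist G (head x) (head y) + sumDist G (tail x) (tail y)
sumDist-∷ G (x ∷ xs) (y ∷ ys) = refl

sumDist-isDistance : (G : FinGraph) → IsDistance (gdist G) → (k : ℕ) → IsDistance (sumDist G {k})
sumDist-isDistance G isDist zero = record { symmetric = λ { [] [] → refl } ; triangle = λ { [] [] [] → z≤n } }
sumDist-isDistance G isDist (suc k) =
  isDistance-product head tail (sumDist-∷ G) isDist (sumDist-isDistance G isDist k)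

dD-isDistance : (m n : ℕ) → IsDistance (dD {m} {n})
dD-isDistance m n = isDistance-product proj₁ proj₂ (λ _ _ → refl)
  (sumDist-isDistance Sh Sh-isDistance m) (sumDist-isDistance K K-isDistance n)

geodesicBound-power : (G : FinGraph) → IsDistance (gdist G) → ∀ {β} → GeodesicBound (gdist G) β →
  (k : ℕ) → GeodesicBound (sumDist G {k}) (β * k)
geodesicBound-power G isDist {β} bound zero v L between =
  ≤-reflexive (trans (∑-cong L (noDistance v))
                     (trans (∑-const 0 L) (trans (*-zeroʳ (length L)) (sym (*-zeroʳ β)))))
  where
  noDistance : (x y : Vec (FinGraph.V G) 0) → sumDist G x y ≡ 0
  noDistance [] [] = refl
geodesicBound-power G isDist {β} bound (suc k) =
  subst (GeodesicBound (sumDist G)) (sym (*-suc β k))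
    (geodesicBound-product head tail (sumDist-∷ G) isDist (sumDist-isDistance G isDist k) bound
      (geodesicBound-power G isDist bound k))

D-geodesicBound : (m n : ℕ) → GeodesicBound (dD {m} {n}) (3 * m + 1 * n)
D-geodesicBound m n =
  geodesicBound-product proj₁ proj₂ (λ _ _ → refl)
    (sumDist-isDistance Sh Sh-isDistance m) (sumDist-isDistance K K-isDistance n)
    (geodesicBound-power Sh Sh-isDistance Sh-geodesicBound m)
    (geodesicBound-power K K-isDistance K-geodesicBound n)

vectors : List A → (k : ℕ) → List (Vec A k)
vectors xs zero = [] ∷ []
vectors xs (suc k) = cartesianProductWith _∷_ xs (vectors xs k)

length-product : (f : A → B → C) (xs : List A) (ys : List B) →
  length (cartesianProductWith f xs ys) ≡ length xs * length ys
length-product f [] ys = refl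
length-product f (x ∷ xs) ys =
  trans (length-++ (map (f x) ys)) (cong₂ _+_ (length-map (f x) ys) (length-product f xs ys))

length-vectors : (xs : List A) (k : ℕ) → length (vectors xs k) ≡ length xs ^ k
length-vectors xs zero = refl
length-vectors xs (suc k) =
  trans (length-product _∷_ xs (vectors xs k)) (cong (length xs *_) (length-vectors xs k))

-- Number of points at distance 2 in the k-th power of a graph with profile (a₁, a₂).
sphere₂ : ℕ → ℕ → ℕ → ℕ
sphere₂ a₁ a₂ zero = 0
sphere₂ a₁ a₂ (suc k) = a₂ + a₁ * (k * a₁) + sphere₂ a₁ a₂ k

profile-power : (G : FinGraph) {a₁ a₂ : ℕ} → (∀ c → Profile (FinGraph.verts G) (gdist G c) a₁ a₂) →
  (k : ℕ) (c : Vec (FinGraph.V G) k) →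
  Profile (vectors (FinGraph.verts G) k) (sumDist G c) (k * a₁) (sphere₂ a₁ a₂ k)
profile-power G profile zero [] .weigh h = ≤-reflexive (+-identityʳ (h 0 + 0))
profile-power G profile (suc k) (c ∷ cs) =
  profile-product _∷_ (FinGraph.verts G) (vectors (FinGraph.verts G) k) (λ x y → refl)
    (profile c) (profile-power G profile k cs)

vertices : (m n : ℕ) → List (D m n)
vertices m n = cartesianProductWith _,_ (vectors allShV m) (vectors allZ4 n)

length-vertices : (m n : ℕ) → length (vertices m n) ≡ 4 ^ (2 * m + n)
length-vertices m n = begin
    length (vertices m n)
  ≡⟨ length-product _,_ (vectors allShV m) (vectors allZ4 n) ⟩
    length (vectors allShV m) * length (vectors allZ4 n)
  ≡⟨ cong₂ _*_ (length-vectors allShV m) (length-vectors allZ4 n) ⟩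
    (4 ^ 2) ^ m * 4 ^ n
  ≡⟨ cong (_* 4 ^ n) (^-*-assoc 4 2 m) ⟩
    4 ^ (2 * m) * 4 ^ n
  ≡⟨ sym (^-distribˡ-+-* 4 (2 * m) n) ⟩
    4 ^ (2 * m + n)
  ∎
  where open ≡-Reasoning

profile-D : (m n : ℕ) (c : D m n) → Profile (vertices m n) (dD c) (m * 6 + n * 3) (sphere₂ 6 9 m)
profile-D m n (s , k) = profile-weaken ≤-refl (≤-trans (m≤m+n _ _) (m≤m+n _ _))
  (profile-product _,_ (vectors allShV m) (vectors allZ4 n) (λ x y → refl)
    (profile-power Sh profile-Sh m s) (profile-power K profile-K n k))

sphere₂-Sh : ∀ m → sphere₂ 6 9 m + 9 * m ≡ 18 * (m * m)
sphere₂-Sh zero = refl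
sphere₂-Sh (suc m) = begin
    9 + 6 * (m * 6) + sphere₂ 6 9 m + 9 * suc m
  ≡⟨ regroup (sphere₂ 6 9 m) m ⟩
    18 + 36 * m + (sphere₂ 6 9 m + 9 * m)
  ≡⟨ cong (18 + 36 * m +_) (sphere₂-Sh m) ⟩
    18 + 36 * m + 18 * (m * m)
  ≡⟨ square m ⟩
    18 * (suc m * suc m)
  ∎
  where
  open ≡-Reasoning
  regroup : ∀ s x → 9 + 6 * (x * 6) + s + 9 * suc x ≡ 18 + 36 * x + (s + 9 * x)
  regroup = solve-∀
  square : ∀ x → 18 + 36 * x + 18 * (x * x) ≡ 18 * (suc x * suc x)
  square = solve-∀

weighted-packing : {m n : ℕ} (h : ℕ → ℕ) (C : List (D m n)) {t : ℕ} →
  (∀ v → ∑[ c ← C ] h (dD c v) ≤ t) →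
  length C * (h 0 + (m * 6 + n * 3) * h 1 + sphere₂ 6 9 m * h 2) ≤ 4 ^ (2 * m + n) * t
weighted-packing {m} {n} h C {t} perVertex =
  subst (λ N → length C * (h 0 + (m * 6 + n * 3) * h 1 + sphere₂ 6 9 m * h 2) ≤ N * t)
        (length-vertices m n)
    (double-count C (vertices m n) (λ c v → h (dD c v)) perVertex (λ c → profile-D m n c .weigh h))

Separated : {m n : ℕ} → ℕ → List (D m n) → Set
Separated d C = ∀ x y → x ∈ C → y ∈ C → x ≢ y → d ≤ dD x y

inBall : ℕ → ℕ
inBall 0 = 1
inBall 1 = 1
inBall (suc (suc _)) = 0

inBall-≤1 : ∀ j → inBall j ≤ 1
inBall-≤1 0 = ≤-refl
inBall-≤1 1 = ≤-refl
inBall-≤1 (suc (suc _)) = z≤n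

inBall-radius : ∀ j → 1 ≤ inBall j → j ≤ 1
inBall-radius 0 _ = z≤n
inBall-radius 1 _ = ≤-refl

balls-disjoint : ∀ x y z → 3 ≤ x → x ≤ y + z → inBall y + inBall z ≤ 1
balls-disjoint x (suc (suc _)) z _ _ = inBall-≤1 z
balls-disjoint x 0 (suc (suc _)) _ _ = ≤-refl
balls-disjoint x 1 (suc (suc _)) _ _ = ≤-refl
balls-disjoint x 0 0 three≤x x≤0 = ⊥-elim (<⇒≱ (≤-trans (s≤s z≤n) three≤x) x≤0)
balls-disjoint x 0 1 three≤x x≤1 = ⊥-elim (<⇒≱ (≤-trans (s≤s (s≤s z≤n)) three≤x) x≤1)
balls-disjoint x 1 0 three≤x x≤1 = ⊥-elim (<⇒≱ (≤-trans (s≤s (s≤s z≤n)) three≤x) x≤1)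
balls-disjoint x 1 1 three≤x x≤2 = ⊥-elim (<⇒≱ three≤x x≤2)

-- 2·[j = 2] is the distance j kept only when it equals 2, the form produced
-- by summing over the codewords filtered to the sphere of radius 2.
twice-onSphere : ∀ j → 2 * indicator 2 j ≡ (if does (j ≟ 2) then j else 0)
twice-onSphere 0 = refl
twice-onSphere 1 = refl
twice-onSphere 2 = refl
twice-onSphere (suc (suc (suc _))) = refl

onSphere-off : ∀ j → j ≢ 2 → indicator 2 j ≡ 0
onSphere-off 0 _ = refl
onSphere-off 1 _ = refl
onSphere-off 2 j≢2 = ⊥-elim (j≢2 refl)
onSphere-off (suc (suc (suc _))) _ = refl

codeWeight : ℕ → ℕ → ℕ
codeWeight β j = β * inBall j + 2 * indicator 2 j

module _ {m n : ℕ} where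
  open IsDistance (dD-isDistance m n)

  ball-bound : {C : List (D m n)} → AllPairs (λ a b → 3 ≤ dD a b) C → ∀ v → ∑[ c ← C ] inBall (dD c v) ≤ 1
  ball-bound apart v = ∑-atMostOne (λ c → inBall (dD c v)) (λ c → inBall-≤1 (dD c v))
    (AllPairs.map (λ {a} {b} far → balls-disjoint (dD a b) (dD a v) (dD b v) far
       (subst (λ t → dD a b ≤ dD a v + t) (symmetric v b) (triangle a v b))) apart)

  -- For codewords pairwise at distance ≥ 4, those at distance 2 from v are
  -- pairwise separated by v; the geodesic bound limits their number.
  sphere-bound : {C : List (D m n)} → AllPairs (λ a b → 4 ≤ dD a b) C →
    ∀ v → 2 * ∑[ c ← C ] indicator 2 (dD c v) ≤ 3 * m + 1 * n
  sphere-bound {C} apart v = begin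
      2 * ∑[ c ← C ] indicator 2 (dD c v)
    ≡⟨ sym (∑-*ˡ 2 _ C) ⟩
      ∑[ c ← C ] (2 * indicator 2 (dD c v))
    ≡⟨ ∑-cong C (λ c → trans (cong (λ j → 2 * indicator 2 j) (symmetric c v)) (twice-onSphere (dD v c))) ⟩
      ∑[ c ← C ] (if does (dD v c ≟ 2) then dD v c else 0)
    ≡⟨ sym (∑-filter (λ c → dD v c ≟ 2) (dD v) C) ⟩
      ∑[ c ← onSphere ] dD v c
    ≤⟨ D-geodesicBound m n v onSphere separated ⟩
      3 * m + 1 * n
    ∎
    where
    open ≤-Reasoning
    onSphere : List (D m n)
    onSphere = filter (λ c → dD v c ≟ 2) C
    separated : AllPairs (Between dD v) onSphere
    separated = allPairs-discharge (all-filter (λ c → dD v c ≟ 2) C)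
      (filter⁺ (λ c → dD v c ≟ 2) (AllPairs.map (λ {a} {b} far va≡2 vb≡2 →
         subst₂ (λ s t → s + t ≤ dD a b) (sym va≡2) (sym vb≡2) far) apart))

  ball-excludes-sphere : {C : List (D m n)} → Separated 4 C →
    ∀ v → 1 ≤ ∑[ c ← C ] inBall (dD c v) → ∑[ c ← C ] indicator 2 (dD c v) ≡ 0
  ball-excludes-sphere {C} separated v occupied with ∑-positive (λ c → inBall (dD c v)) C occupied
  ... | c , c∈C , near = ∑-zero (λ c′ → indicator 2 (dD c′ v)) C
    (λ c′ c′∈C → onSphere-off (dD c′ v) (λ c′v≡2 → <⇒≱ (s≤s (s≤s (s≤s (s≤s z≤n))))
       (≤-trans (separated c c′ c∈C c′∈C (distinct c′ c′v≡2)) (close c′ c′v≡2))))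
    where
    cv≤1 : dD c v ≤ 1
    cv≤1 = inBall-radius (dD c v) near
    distinct : ∀ c′ → dD c′ v ≡ 2 → c ≢ c′
    distinct c′ c′v≡2 refl = <⇒≱ (s≤s (s≤s z≤n)) (subst (_≤ 1) c′v≡2 cv≤1)
    close : ∀ c′ → dD c′ v ≡ 2 → dD c c′ ≤ 3
    close c′ c′v≡2 = ≤-trans (triangle c v c′) (+-mono-≤ cv≤1 (≤-reflexive (trans (symmetric v c′) c′v≡2)))

  weighted-vertex-bound : {C : List (D m n)} → Unique C → Separated 4 C →
    ∀ v → ∑[ c ← C ] codeWeight (3 * m + 1 * n) (dD c v) ≤ 3 * m + 1 * n
  weighted-vertex-bound {C} unique separated v =
    subst (_≤ β) (sym (trans (∑-+ _ _ C) (cong₂ _+_ (∑-*ˡ β _ C) (∑-*ˡ 2 _ C))))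
      (byBallCount ballCount refl (ball-bound apart₃ v))
    where
    β = 3 * m + 1 * n
    ballCount = ∑[ c ← C ] inBall (dD c v)
    sphereCount = ∑[ c ← C ] indicator 2 (dD c v)
    apart₄ : AllPairs (λ a b → 4 ≤ dD a b) C
    apart₄ = unique⇒allPairs unique separated
    apart₃ : AllPairs (λ a b → 3 ≤ dD a b) C
    apart₃ = AllPairs.map (≤-trans (n≤1+n 3)) apart₄
    byBallCount : ∀ k → ballCount ≡ k → k ≤ 1 → β * k + 2 * sphereCount ≤ β
    byBallCount 0 _ _ = subst (λ t → t + 2 * sphereCount ≤ β) (sym (*-zeroʳ β)) (sphere-bound apart₄ v)
    byBallCount 1 oneBall _ = ≤-reflexive (begin
        β * 1 + 2 * sphereCount
      ≡⟨ cong (λ s → β * 1 + 2 * s) (ball-excludes-sphere separated v (≤-reflexive (sym oneBall))) ⟩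
        β * 1 + 0
      ≡⟨ trans (+-identityʳ (β * 1)) (*-identityʳ β) ⟩
        β
      ∎)
      where open ≡-Reasoning
    byBallCount (suc (suc _)) _ (s≤s ())

cancel-power : (N k a b : ℕ) → k ≤ N → 4 ^ (N ∸ k) * a ≤ 4 ^ N * b → a ≤ 4 ^ k * b
cancel-power N k a b k≤N bound =
  *-cancelˡ-≤ (4 ^ (N ∸ k)) {{m^n≢0 4 (N ∸ k)}} (subst (4 ^ (N ∸ k) * a ≤_) split bound)
  where
  split : 4 ^ N * b ≡ 4 ^ (N ∸ k) * (4 ^ k * b)
  split = begin
      4 ^ N * b
    ≡⟨ cong (λ e → 4 ^ e * b) (sym (m+[n∸m]≡n k≤N)) ⟩
      4 ^ (k + (N ∸ k)) * b
    ≡⟨ cong (_* b) (^-distribˡ-+-* 4 k (N ∸ k)) ⟩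
      4 ^ k * 4 ^ (N ∸ k) * b
    ≡⟨ rearrange (4 ^ k) (4 ^ (N ∸ k)) b ⟩
      4 ^ (N ∸ k) * (4 ^ k * b)
    ∎
    where
    open ≡-Reasoning
    rearrange : ∀ x y z → x * y * z ≡ y * (x * z)
    rearrange = solve-∀

puncture : {m n : ℕ} → D m (suc n) → D m n
puncture (s , k ∷ ks) = s , ks

puncture-distance : {m n : ℕ} (x y : D m (suc n)) → dD x y ≤ dD (puncture x) (puncture y) + 1
puncture-distance (s , k ∷ ks) (s′ , k′ ∷ ks′) = begin
    a + (gdist K k k′ + b)
  ≤⟨ +-monoʳ-≤ a (+-monoˡ-≤ b (K-≤1 k k′)) ⟩
    a + suc b
  ≡⟨ trans (+-suc a b) (sym (+-comm (a + b) 1)) ⟩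
    a + b + 1
  ∎
  where
  open ≤-Reasoning
  a = sumDist Sh s s′
  b = sumDist K ks ks′

-- With a K-coordinate (N = 2m + n + 1): puncturing it leaves 4^(N−3) codewords
-- at pairwise distance ≥ 3 in D(m,n), whose disjoint balls of size
-- 1 + 6m + 3n = 1 + 3(N − 1) ≥ 19 cannot fit into the 4^(N−1) vertices.
no-code-with-K : (m n : ℕ) → 6 ≤ 2 * m + n → (C : List (D m (suc n))) →
  length C ≡ 4 ^ (2 * m + n ∸ 2) → AllPairs (λ a b → 4 ≤ dD a b) C → ⊥
no-code-with-K m n six C size apart =
  <⇒≱ ballTooLarge (cancel-power (2 * m + n) 2 ballSize 1 (≤-trans (s≤s (s≤s z≤n)) six) packed)
  where
  punctured = map puncture C
  apart₃ : AllPairs (λ a b → 3 ≤ dD a b) punctured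
  apart₃ = map⁺ (AllPairs.map (λ {a} {b} far →
    ≤-pred (subst (4 ≤_) (+-comm _ 1) (≤-trans far (puncture-distance a b)))) apart)
  ballSize = 1 + (m * 6 + n * 3) * 1 + sphere₂ 6 9 m * 0
  packed : 4 ^ (2 * m + n ∸ 2) * ballSize ≤ 4 ^ (2 * m + n) * 1
  packed = subst (λ ℓ → ℓ * ballSize ≤ 4 ^ (2 * m + n) * 1) (trans (length-map puncture C) size)
    (weighted-packing inBall punctured (ball-bound apart₃))
  ballTooLarge : 16 < ballSize
  ballTooLarge = subst (16 <_) (sym (closed m n (sphere₂ 6 9 m))) (s≤s (≤-trans (m≤m+n 16 2) (*-monoʳ-≤ 3 six)))
    where
    closed : ∀ x y s → 1 + (x * 6 + y * 3) * 1 + s * 0 ≡ 1 + 3 * (2 * x + y)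
    closed = solve-∀

-- The weight received by a codeword of Sh^m under codeWeight (3m), taken from
-- the profile of D(m,0).
shWeight : ℕ → ℕ
shWeight m = codeWeight β 0 + (m * 6 + 0 * 3) * codeWeight β 1 + sphere₂ 6 9 m * codeWeight β 2
  where β = 3 * m + 1 * 0

-- shWeight m = 3m(1 + 6m) + 2(18m² − 9m) = 54m² − 15m exceeds 64·3m once m ≥ 4.
shWeight-too-large : ∀ m → 4 ≤ m → ¬ (shWeight m ≤ 4 ^ 3 * (3 * m + 1 * 0))
shWeight-too-large m@(suc _) four bound = from-no (219 ≤? 210) (*-cancelʳ-≤ 219 210 m (begin
    219 * m
  ≡⟨ split m ⟩
    54 * (4 * m) + 3 * m
  ≤⟨ +-monoˡ-≤ (3 * m) (*-monoʳ-≤ 54 (*-monoˡ-≤ m four)) ⟩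
    54 * (m * m) + 3 * m
  ≡⟨ sym (collect m) ⟩
    3 * m + 18 * (m * m) + 2 * (18 * (m * m))
  ≡⟨ cong (λ t → 3 * m + 18 * (m * m) + 2 * t) (sym (sphere₂-Sh m)) ⟩
    3 * m + 18 * (m * m) + 2 * (sphere₂ 6 9 m + 9 * m)
  ≡⟨ sym (expand m (sphere₂ 6 9 m)) ⟩
    shWeight m + 18 * m
  ≤⟨ +-monoˡ-≤ (18 * m) bound ⟩
    64 * (3 * m + 0) + 18 * m
  ≡⟨ final m ⟩
    210 * m
  ∎))
  where
  open ≤-Reasoning
  split : ∀ x → 219 * x ≡ 54 * (4 * x) + 3 * x
  split = solve-∀
  collect : ∀ x → 3 * x + 18 * (x * x) + 2 * (18 * (x * x)) ≡ 54 * (x * x) + 3 * x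
  collect = solve-∀
  expand : ∀ x s → (3 * x + 0) * 1 + 2 * 0 + (x * 6 + 0) * ((3 * x + 0) * 1 + 2 * 0)
                   + s * ((3 * x + 0) * 0 + 2 * 1) + 18 * x
                 ≡ 3 * x + 18 * (x * x) + 2 * (s + 9 * x)
  expand = solve-∀
  final : ∀ x → 64 * (3 * x + 0) + 18 * x ≡ 210 * x
  final = solve-∀

no-code-in-Shᵐ : (m : ℕ) → 4 ≤ m → (C : List (D m 0)) → Unique C →
  length C ≡ 4 ^ (2 * m + 0 ∸ 3) → Separated 4 C → ⊥
no-code-in-Shᵐ m four C unique size separated =
  shWeight-too-large m four (cancel-power (2 * m + 0) 3 (shWeight m) (3 * m + 1 * 0) three≤N packed)
  where
  three≤N : 3 ≤ 2 * m + 0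
  three≤N = ≤-trans (n≤1+n 3) (≤-trans four (≤-trans (m≤m+n m (m + 0)) (m≤m+n (2 * m) 0)))
  packed : 4 ^ (2 * m + 0 ∸ 3) * shWeight m ≤ 4 ^ (2 * m + 0) * (3 * m + 1 * 0)
  packed = subst (λ ℓ → ℓ * shWeight m ≤ 4 ^ (2 * m + 0) * (3 * m + 1 * 0)) size
    (weighted-packing (codeWeight (3 * m + 1 * 0)) C (weighted-vertex-bound unique separated))

four≤m : ∀ m → 6 < 2 * m + 0 → 4 ≤ m
four≤m m six<2m with 4 ≤? m
... | yes m≥4 = m≥4
... | no m≱4 = ⊥-elim (<⇒≱ six<2m (subst (_≤ 6) (sym (+-identityʳ (2 * m)))
                                           (*-monoʳ-≤ 2 (≤-pred (≰⇒> m≱4)))))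

lemma16 : (m n : ℕ) → 6 < 2 * m + n → (C : List (D m n)) →
    ¬ (Unique C × length C ≡ 4 ^ (2 * m + n ∸ 3) × HasCodeDistance C 4)
lemma16 m zero six<N C (unique , size , separated , _) =
  no-code-in-Shᵐ m (four≤m m six<N) C unique size separated
lemma16 m (suc n) six<N C (unique , size , separated , _) =
  no-code-with-K m n (≤-pred (subst (6 <_) (+-suc (2 * m) n) six<N)) C
    (trans size (cong (λ e → 4 ^ (e ∸ 3)) (+-suc (2 * m) n)))
    (unique⇒allPairs unique separated)
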